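{- Let $u\in\mathfrak{S}_n$ and let $\beta(u)\subseteq\mathfrak{B}_n$ be the set of $2^n$ signed permutations obtained from $u$ by attaching signs to its entries in all possible ways. Then either $\beta(u)\subseteq\mathfrak{B}_{n,\mathfrak{D}}^+$ or $\beta(u)\subseteq\mathfrak{B}_{n,\mathfrak{D}}^-$. Consequently, for $u\in\mathfrak{S}_n$, $u\in\mathfrak{B}_{n,\mathfrak{D}}^+$ if and only if $u\in\mathcal{A}_n$.
   Context: $\mathfrak{B}_n$ is the group of signed permutations $w=w_1\cdots w_n$ of $\{\pm1,\dots,\pm n\}$ ($w(-i)=-w(i)$), containing $\mathfrak{S}_n$ as the elements with no negative entries; $\mathcal{A}_n$ is the alternating group. For $w\in\mathfrak{B}_n$, $\mathsf{inv}_D(w)=|\{1\le i<j\le n:w_i>w_j\}|+|\{1\le i<j\le n:-w_i>w_j\}|$. $\mathfrak{B}_{n,\mathfrak{D}}^+=\{w\in\mathfrak{B}_n:\mathsf{inv}_D(w)\text{ even}\}$, $\mathfrak{B}_{n,\mathfrak{D}}^-=\{w\in\mathfrak{B}_n:\mathsf{inv}_D(w)\text{ odd}\}$. -}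

module Defs where

open import Data.Bool using (Bool; true; false; if_then_else_)
open import Data.Nat using (ℕ; zero; suc; _+_)
open import Data.Nat.Divisibility using (_∣_)
open import Data.Integer as ℤ using (ℤ; +_; -_)
open import Data.Fin using (Fin; toℕ)
open import Data.Fin.Permutation using (Permutation′; _⟨$⟩ʳ_)
open import Data.List using (List; map; allFin)
open import Data.Nat.ListAction using (sum)
open import Data.Product using (_×_; _,_; proj₁; proj₂)
open import Relation.Nullary.Decidable using (⌊_⌋)

countPairs : ∀ {n} → (Fin n → Fin n → Bool) → ℕ
countPairs {n} P =
  sum (map (λ i → sum (map (λ j → if ⌊ toℕ i Data.Nat.<? toℕ j ⌋ ∧ P i j then 1 else 0)
                              (allFin n))) (allFin n))
  where open import Data.Bool using (_∧_)

-- A signed permutation w ∈ 𝔅ₙ: an underlying permutation |w| ∈ 𝔖ₙ together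
-- with a sign for each position (true = negative).  The one-line notation
-- is w_i = ± (|w|(i) + 1) ∈ {±1,…,±n}.
SignedPerm : ℕ → Set
SignedPerm n = Permutation′ n × (Fin n → Bool)

entry : ∀ {n} → SignedPerm n → Fin n → ℤ
entry (u , s) i = if s i then - (+ suc (toℕ (u ⟨$⟩ʳ i))) else + suc (toℕ (u ⟨$⟩ʳ i))

unsigned : ∀ {n} → Permutation′ n → SignedPerm n
unsigned u = u , λ _ → false

inβ : ∀ {n} → Permutation′ n → SignedPerm n → Set
inβ u w = proj₁ w Data.Fin.Permutation.≈ u

invD : ∀ {n} → SignedPerm n → ℕ
invD w = countPairs (λ i j → ⌊ entry w j ℤ.<? entry w i ⌋)
       + countPairs (λ i j → ⌊ entry w j ℤ.<? - entry w i ⌋)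

Even Odd : ℕ → Set
Even k = 2 ∣ k
Odd k = 2 ∣ suc k

inBplus inBminus : ∀ {n} → SignedPerm n → Set
inBplus w = Even (invD w)
inBminus w = Odd (invD w)

inv : ∀ {n} → Permutation′ n → ℕ
inv u = countPairs (λ i j → ⌊ toℕ (u ⟨$⟩ʳ j) Data.Nat.<? toℕ (u ⟨$⟩ʳ i) ⌋)

inA : ∀ {n} → Permutation′ n → Set
inA u = Even (inv u)

-- For i < j the two indicators [w_j < w_i] and [w_j < -w_i] together count how many of
-- the two numbers ±|w_i| lie above w_j.  As |w_i| ≠ |w_j|, this count is 1 when
-- |w_j| < |w_i| and 0 or 2 otherwise, whatever the signs.  Summing over all pairs gives
-- inv_D(w) ≡ inv(|w|) (mod 2), so inv_D is of constant parity on β(u), namely that of inv(u).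
module Submission where

open import Defs
open import Algebra.Properties.CommutativeSemigroup using (interchange)
open import Data.Bool using (Bool; true; false; if_then_else_; _∧_)
open import Data.Fin using (Fin; toℕ)
open import Data.Fin.Permutation using (Permutation′; _≈_)
open import Data.Fin.Properties using (toℕ-injective)
import Data.Fin.Properties as Fin
open import Data.Integer as ℤ using (ℤ; +[1+_]; -[1+_])
open import Data.List using (List; []; _∷_; map; allFin)
open import Data.List.Properties using (map-cong)
open import Data.Nat as ℕ using (ℕ; zero; suc; _+_; _*_; _<?_)
open import Data.Nat.Divisibility using (_∣_; divides; ∣m∣n⇒∣m+n; ∣m+n∣m⇒∣n; m∣m*n)
open import Data.Nat.ListAction using (sum)
open import Data.Nat.Properties
  using (+-comm; +-assoc; +-identityʳ; *-distribˡ-+; <-asym; ≤-antisym; ≮⇒≥; +-commutativeSemigroup)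
open import Data.Product using (_×_; _,_; proj₁)
open import Data.Sum using (_⊎_; inj₁; inj₂)
open import Function using (_∘_)
open import Function.Bundles using (Injection; _⇔_; mk⇔; module Equivalence)
open import Function.Properties.Inverse using (↔⇒↣)
open import Relation.Nullary using (Dec; yes; no; contradiction)
open import Relation.Nullary.Decidable using (⌊_⌋; does; isYes≗does)
open import Relation.Binary.PropositionalEquality

𝟙 : Bool → ℕ
𝟙 b = if b then 1 else 0

infix 4 _≡_+even

record _≡_+even (m n : ℕ) : Set where
  constructor gap
  field
    half : ℕ
    m≡n+2*half : m ≡ n + 2 * half

+even-refl : ∀ {n} → n ≡ n +even
+even-refl {n} = gap 0 (sym (+-identityʳ n))

+even-+ : ∀ {m n m′ n′} → m ≡ n +even → m′ ≡ n′ +even → m + m′ ≡ n + n′ +even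
+even-+ {m} {n} {m′} {n′} (gap k m≡) (gap k′ m′≡) = gap (k + k′) (begin
  m + m′                      ≡⟨ cong₂ _+_ m≡ m′≡ ⟩
  (n + 2 * k) + (n′ + 2 * k′) ≡⟨ interchange +-commutativeSemigroup n (2 * k) n′ (2 * k′) ⟩
  (n + n′) + (2 * k + 2 * k′) ≡⟨ cong ((n + n′) +_) (*-distribˡ-+ 2 k k′) ⟨
  (n + n′) + 2 * (k + k′)     ∎)
  where open ≡-Reasoning

Even⇔Even : ∀ {m n} → m ≡ n +even → Even m ⇔ Even n
Even⇔Even {m} {n} (gap k refl) = mk⇔
  (λ 2∣m → ∣m+n∣m⇒∣n (subst (2 ∣_) (+-comm n (2 * k)) 2∣m) (m∣m*n k))
  (λ 2∣n → ∣m∣n⇒∣m+n 2∣n (m∣m*n k))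

Odd⇔Odd : ∀ {m n} → m ≡ n +even → Odd m ⇔ Odd n
Odd⇔Odd (gap k m≡) = Even⇔Even (gap k (cong suc m≡))

even⊎odd : ∀ m → Even m ⊎ Odd m
even⊎odd zero = inj₁ (divides 0 refl)
even⊎odd (suc m) with even⊎odd m
... | inj₁ 2∣m = inj₂ (∣m∣n⇒∣m+n (divides 1 refl) 2∣m)
... | inj₂ 2∣1+m = inj₁ 2∣1+m

sum-map-+even : ∀ {A : Set} {f g h : A → ℕ} (xs : List A) →
  (∀ x → f x + g x ≡ h x +even) →
  sum (map f xs) + sum (map g xs) ≡ sum (map h xs) +even
sum-map-+even [] _ = +even-refl
sum-map-+even {f = f} {g} {h} (x ∷ xs) f+g≡h =
  subst (_≡ h x + sum (map h xs) +even)
    (interchange +-commutativeSemigroup (f x) (g x) (sum (map f xs)) (sum (map g xs)))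
    (+even-+ (f+g≡h x) (sum-map-+even xs f+g≡h))

countPairs-+even : ∀ {n} {P Q R : Fin n → Fin n → Bool} →
  (∀ i j → toℕ i ℕ.< toℕ j → 𝟙 (P i j) + 𝟙 (Q i j) ≡ 𝟙 (R i j) +even) →
  countPairs P + countPairs Q ≡ countPairs R +even
countPairs-+even {n} {P} {Q} {R} pair =
  sum-map-+even (allFin n) λ i → sum-map-+even (allFin n) λ j → pair′ i j
  where
  pair′ : ∀ i j → 𝟙 (⌊ toℕ i <? toℕ j ⌋ ∧ P i j) + 𝟙 (⌊ toℕ i <? toℕ j ⌋ ∧ Q i j)
                ≡ 𝟙 (⌊ toℕ i <? toℕ j ⌋ ∧ R i j) +even
  pair′ i j with toℕ i <? toℕ j
  ... | yes i<j = pair i j i<j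
  ... | no _ = +even-refl

countPairs-cong : ∀ {n} {P Q : Fin n → Fin n → Bool} →
  (∀ i j → P i j ≡ Q i j) → countPairs P ≡ countPairs Q
countPairs-cong {n} P≡Q =
  cong sum (map-cong (λ i → cong sum (map-cong (λ j → cong (count i j) (P≡Q i j)) (allFin n)))
                     (allFin n))
  where
  count : Fin n → Fin n → Bool → ℕ
  count i j b = 𝟙 (⌊ toℕ i <? toℕ j ⌋ ∧ b)

inv-cong : ∀ {n} {π ρ : Permutation′ n} → π ≈ ρ → inv π ≡ inv ρ
inv-cong π≈ρ = countPairs-cong λ i j →
  cong₂ (λ x y → ⌊ toℕ y <? toℕ x ⌋) (π≈ρ i) (π≈ρ j)

<-xor : ∀ {a b} → a ≢ b → 𝟙 ⌊ a <? b ⌋ + 𝟙 ⌊ b <? a ⌋ ≡ 1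
<-xor {a} {b} a≢b with a <? b | b <? a
... | yes a<b | yes b<a = contradiction b<a (<-asym a<b)
... | yes _   | no _    = refl
... | no _    | yes _   = refl
... | no a≮b  | no b≮a  = contradiction (≤-antisym (≮⇒≥ b≮a) (≮⇒≥ a≮b)) a≢b

-- ⌊_⌋ is stuck on the integer and natural decisions used below, while their `does`
-- fields compute to the same boolean.
⌊⌋-does : ∀ {A B : Set} (a? : Dec A) (b? : Dec B) → does a? ≡ does b? → ⌊ a? ⌋ ≡ ⌊ b? ⌋
⌊⌋-does a? b? eq = trans (isYes≗does a?) (trans eq (sym (isYes≗does b?)))

-- entry (π , s) i unfolds to signed (s i) (toℕ (π ⟨$⟩ʳ i)).
signed : Bool → ℕ → ℤ
signed s m = if s then ℤ.- +[1+ m ] else +[1+ m ]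

below-± : ∀ {a b} → a ≢ b → ∀ s →
  𝟙 ⌊ signed s b ℤ.<? +[1+ a ] ⌋ + 𝟙 ⌊ signed s b ℤ.<? -[1+ a ] ⌋ ≡ 𝟙 ⌊ b <? a ⌋ +even
below-± _ false = gap 0 (cong (λ c → 𝟙 c + 0) (⌊⌋-does _ _ refl))
below-± {a} {b} a≢b true = gap x (begin
  1 + 𝟙 ⌊ -[1+ b ] ℤ.<? -[1+ a ] ⌋ ≡⟨ cong (λ c → 1 + 𝟙 c) (⌊⌋-does _ _ refl) ⟩
  1 + x                            ≡⟨ cong (_+ x) (<-xor a≢b) ⟨
  (x + y) + x                      ≡⟨ cong (_+ x) (+-comm x y) ⟩
  (y + x) + x                      ≡⟨ +-assoc y x x ⟩
  y + (x + x)                      ≡⟨ cong (λ c → y + (x + c)) (+-identityʳ x) ⟨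
  y + 2 * x                        ∎)
  where
  open ≡-Reasoning
  x y : ℕ
  x = 𝟙 ⌊ a <? b ⌋
  y = 𝟙 ⌊ b <? a ⌋

below-signed : ∀ {a b} → a ≢ b → ∀ sa sb →
  𝟙 ⌊ signed sb b ℤ.<? signed sa a ⌋ + 𝟙 ⌊ signed sb b ℤ.<? ℤ.- signed sa a ⌋
    ≡ 𝟙 ⌊ b <? a ⌋ +even
below-signed a≢b false sb = below-± a≢b sb
below-signed {a} {b} a≢b true sb =
  subst (_≡ 𝟙 ⌊ b <? a ⌋ +even)
    (+-comm (𝟙 ⌊ signed sb b ℤ.<? +[1+ a ] ⌋) (𝟙 ⌊ signed sb b ℤ.<? -[1+ a ] ⌋))
    (below-± a≢b sb)

invD≡inv+even : ∀ {n} (w : SignedPerm n) → invD w ≡ inv (proj₁ w) +even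
invD≡inv+even (π , s) = countPairs-+even λ i j i<j →
  below-signed (Fin.<⇒≢ i<j ∘ Injection.injective (↔⇒↣ π) ∘ toℕ-injective) (s i) (s j)

lemma33 : (n : ℕ) → (u : Permutation′ n) →
    (((w : SignedPerm n) → inβ u w → inBplus w)
      ⊎ ((w : SignedPerm n) → inβ u w → inBminus w))
    × (inBplus (unsigned u) ⇔ inA u)
lemma33 n u = constant-on-β (even⊎odd (inv u)) , Even⇔Even (invD-β (unsigned u) λ _ → refl)
  where
  invD-β : ∀ w → inβ u w → invD w ≡ inv u +even
  invD-β w w∈β = subst (invD w ≡_+even) (inv-cong {π = proj₁ w} {u} w∈β) (invD≡inv+even w)

  constant-on-β : Even (inv u) ⊎ Odd (inv u) →
    ((w : SignedPerm n) → inβ u w → inBplus w) ⊎ ((w : SignedPerm n) → inβ u w → inBminus w)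
  constant-on-β (inj₁ even) = inj₁ λ w w∈β → Equivalence.from (Even⇔Even (invD-β w w∈β)) even
  constant-on-β (inj₂ odd)  = inj₂ λ w w∈β → Equivalence.from (Odd⇔Odd (invD-β w w∈β)) odd
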